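{- For any graph $G$ with $n$ vertices and no isolated vertices, $$\operatorname{avd}(G) \le \frac{n}{2} + \sum_{v \in V(G)} \frac{\deg(v)}{2^{\deg(v)+1} - 2}.$$
   Context: Graphs are finite and simple. A set $S \subseteq V(G)$ is a dominating set of $G$ if every vertex of $G$ is in $S$ or adjacent to a vertex of $S$. Let $\mathcal{D}(G)$ be the collection of dominating sets of $G$. The average order of dominating sets is $\operatorname{avd}(G) = \frac{1}{|\mathcal{D}(G)|}\sum_{S \in \mathcal{D}(G)} |S|$. -}

module Defs where

open import Data.Nat using (ℕ; zero; suc; _+_; _∸_; _^_)
open import Data.Bool using (Bool; true; false; _∧_; _∨_; not; if_then_else_)
open import Data.Fin using (Fin)
open import Data.Vec using (Vec; []; _∷_; lookup)
open import Data.List using (List; []; _∷_; map; _++_; filter; length)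
open import Data.Nat.ListAction using (sum)
open import Data.Fin.Subset using (Subset; ∣_∣)
open import Data.Product using (Σ; _×_)
open import Relation.Binary.PropositionalEquality using (_≡_)
open import Relation.Nullary using (¬_)
open import Relation.Nullary.Decidable using (Dec; yes; no)
open import Data.Integer using (+_)
open import Data.Rational using (ℚ; 0ℚ; _/_; _+_)

record Graph (n : ℕ) : Set where
  field
    adj     : Fin n → Fin n → Bool
    irrefl  : ∀ v → adj v v ≡ false
    sym     : ∀ u v → adj u v ≡ adj v u
open Graph public

anyFin : ∀ {n} → (Fin n → Bool) → Bool
anyFin {zero}  f = false
anyFin {suc n} f = f Fin.zero ∨ anyFin (λ i → f (Fin.suc i))

allFin : ∀ {n} → (Fin n → Bool) → Bool
allFin {zero}  f = true
allFin {suc n} f = f Fin.zero ∧ allFin (λ i → f (Fin.suc i))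

sumFin : ∀ {n} → (Fin n → ℚ) → ℚ
sumFin {zero}  f = 0ℚ
sumFin {suc n} f = f Fin.zero Data.Rational.+ sumFin (λ i → f (Fin.suc i))

countFin : ∀ {n} → (Fin n → Bool) → ℕ
countFin {zero}  f = zero
countFin {suc n} f = (if f Fin.zero then 1 else 0) Data.Nat.+ countFin (λ i → f (Fin.suc i))

deg : ∀ {n} → Graph n → Fin n → ℕ
deg G v = countFin (λ u → adj G v u)

NoIsolated : ∀ {n} → Graph n → Set
NoIsolated G = ∀ v → ¬ (deg G v ≡ 0)

allSubsets : (n : ℕ) → List (Subset n)
allSubsets zero    = [] ∷ []
allSubsets (suc n) = map (true ∷_) (allSubsets n) ++ map (false ∷_) (allSubsets n)

isDominating : ∀ {n} → Graph n → Subset n → Bool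
isDominating G S = allFin (λ v → lookup S v ∨ anyFin (λ u → lookup S u ∧ adj G v u))

dominatingSets : ∀ {n} → Graph n → List (Subset n)
dominatingSets {n} G = filter (λ S → isDominating G S Data.Bool.≟ true) (allSubsets n)

-- a / b as a rational; only used with b ≠ 0 (returns 0 for b = 0).
frac : ℕ → ℕ → ℚ
frac a zero    = 0ℚ
frac a (suc b) = (+ a) / suc b

avd : ∀ {n} → Graph n → ℚ
avd G = frac (sum (map ∣_∣ (dominatingSets G))) (length (dominatingSets G))

avdBound : ∀ {n} → Graph n → ℚ
avdBound {n} G = frac n 2 Data.Rational.+ sumFin (λ v → frac (deg G v) (2 ^ (deg G v Data.Nat.+ 1) ∸ 2))

module Submission where

-- Write D for the number of dominating sets, D_v (D̄_v) for the number of
-- those containing (avoiding) v, and P(u,v) for the number of dominating sets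
-- S in which u is a private neighbour of v, i.e. v ∈ S and S ∩ N[u] = {v}.
--  (1) If S ∌ v and S ∪ {v} is dominating, then either S is dominating or some
--      u is a private neighbour of v with respect to S ∪ {v}.  Hence
--      D_v ≤ D̄_v + Σ_u P(u,v), so 2 D_v ≤ D + Σ_u P(u,v), and summing over v,
--      2 Σ_{S dominating} |S| ≤ n D + Σ_u Σ_v P(u,v).
--  (2) Fix u of degree d.  A set counted by P(u,v) has 2^d − 1 supersets that
--      agree with it outside N[u] and do not cover N[u]; such a superset and v
--      determine the set, and v is one of the at most d vertices it has in N[u].
--      Hence (Σ_v P(u,v)) · (2^d − 1) ≤ d D.
--  (3) Dividing (1) by 2D and bounding each u-term with (2) gives the theorem.

open import Defs hiding (sym)
open import Data.Nat using (ℕ)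
open import Relation.Binary.PropositionalEquality using (subst)

module Combinatorics where

  open import Data.Nat using (zero; suc; _+_; _*_; _∸_; _^_; _≤_; z≤n; s≤s)
  open import Data.Nat.Properties hiding (_≟_)
  open import Data.Bool using (Bool; true; false; _∧_; _∨_; not; if_then_else_)
  import Data.Bool as Bool
  open import Data.Bool.Properties
    using (∧-conicalˡ; ∧-conicalʳ; ∧-zeroʳ; ∧-comm; ∨-zeroʳ; ∨-conicalˡ; ∨-conicalʳ; not-injective)
  open import Data.Fin using (Fin; zero; suc; _≟_)
  open import Data.Vec using ([]; _∷_; lookup; _[_]≔_)
  open import Data.Vec.Properties using (lookup∘update; lookup∘update′)
  open import Data.Fin.Subset using (Subset; ∣_∣)
  open import Data.List using (List; []; _∷_; map; _++_; filter; length)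
  import Data.Nat.ListAction as List
  open import Data.Nat.ListAction.Properties using (sum-++)
  open import Data.List.Properties using (map-++; map-∘)
  open import Data.Product using (∃-syntax; _,_; _×_; proj₁; proj₂)
  open import Relation.Binary.PropositionalEquality
  open import Relation.Nullary using (Dec; does; yes; no; contradiction)
  open import Relation.Nullary.Decidable using (dec-true)
  open import Relation.Unary using (Pred; Decidable)
  open import Level using (0ℓ)
  open import Function using (_∘_)
  open import Algebra.Properties.CommutativeSemigroup +-commutativeSemigroup using (interchange)
  open import Algebra.Properties.Semiring.Sum +-*-semiring
    using (sum-syntax; ∑-distrib-+; ∑-comm; *-distribˡ-sum; *-distribʳ-sum; sum-cong-≗) renaming (sum to ∑)

  χ : Bool → ℕ
  χ true  = 1
  χ false = 0

  true≢false : ∀ {A : Set} {b} → b ≡ true → b ≡ false → A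
  true≢false refl ()

  χ-∧ : ∀ a b → χ (a ∧ b) ≡ χ a * χ b
  χ-∧ true  b = sym (*-identityˡ (χ b))
  χ-∧ false b = refl

  χ-split : ∀ a b → χ a ≡ χ (a ∧ b) + χ (a ∧ not b)
  χ-split true  true  = refl
  χ-split true  false = refl
  χ-split false b     = refl

  χ-weighted : ∀ b {x y} → (b ≡ true → x ≡ y) → χ b * x ≡ χ b * y
  χ-weighted true  x≡y = cong (1 *_) (x≡y refl)
  χ-weighted false x≡y = refl

  one-of-two : ∀ t → χ (does (true Bool.≟ t)) + χ (does (false Bool.≟ t)) ≡ 1
  one-of-two true  = refl
  one-of-two false = refl

  does-≟-true : ∀ b → does (b Bool.≟ true) ≡ b
  does-≟-true true  = refl
  does-≟-true false = refl

  does⇒proof : ∀ {A : Set} (a? : Dec A) → does a? ≡ true → A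
  does⇒proof (yes a) _ = a

  _==_ : ∀ {n} → Fin n → Fin n → Bool
  v == w = does (v ≟ w)

  ==-refl : ∀ {n} (v : Fin n) → (v == v) ≡ true
  ==-refl v = dec-true (v ≟ v) refl

  ∑-mono : ∀ {n} {f g : Fin n → ℕ} → (∀ i → f i ≤ g i) → ∑[ i < n ] f i ≤ ∑[ i < n ] g i
  ∑-mono {zero}  h = z≤n
  ∑-mono {suc n} h = +-mono-≤ (h zero) (∑-mono (λ i → h (suc i)))

  ∑-const : ∀ n c → ∑[ i < n ] c ≡ n * c
  ∑-const zero    c = refl
  ∑-const (suc n) c = cong (c +_) (∑-const n c)

  ∑-term : ∀ {n} (f : Fin n → ℕ) (i : Fin n) → f i ≤ ∑[ j < n ] f j
  ∑-term f zero    = m≤m+n _ _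
  ∑-term f (suc i) = ≤-trans (∑-term (λ j → f (suc j)) i) (m≤n+m _ _)

  ∑ˢ : ∀ {n} → (Subset n → ℕ) → ℕ
  ∑ˢ {zero}  f = f []
  ∑ˢ {suc n} f = ∑ˢ (λ S → f (true ∷ S)) + ∑ˢ (λ S → f (false ∷ S))

  ∑ˢ-cong : ∀ {n} {f g : Subset n → ℕ} → (∀ S → f S ≡ g S) → ∑ˢ f ≡ ∑ˢ g
  ∑ˢ-cong {zero}  e = e []
  ∑ˢ-cong {suc n} e = cong₂ _+_ (∑ˢ-cong (λ S → e (true ∷ S))) (∑ˢ-cong (λ S → e (false ∷ S)))

  ∑ˢ-mono : ∀ {n} {f g : Subset n → ℕ} → (∀ S → f S ≤ g S) → ∑ˢ f ≤ ∑ˢ g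
  ∑ˢ-mono {zero}  h = h []
  ∑ˢ-mono {suc n} h = +-mono-≤ (∑ˢ-mono (λ S → h (true ∷ S))) (∑ˢ-mono (λ S → h (false ∷ S)))

  ∑ˢ-zero : ∀ n → ∑ˢ {n} (λ _ → 0) ≡ 0
  ∑ˢ-zero zero    = refl
  ∑ˢ-zero (suc n) = cong₂ _+_ (∑ˢ-zero n) (∑ˢ-zero n)

  ∑ˢ-distrib-+ : ∀ {n} (f g : Subset n → ℕ) → ∑ˢ (λ S → f S + g S) ≡ ∑ˢ f + ∑ˢ g
  ∑ˢ-distrib-+ {zero}  f g = refl
  ∑ˢ-distrib-+ {suc n} f g =
    trans (cong₂ _+_ (∑ˢ-distrib-+ (λ S → f (true ∷ S)) (λ S → g (true ∷ S)))
                     (∑ˢ-distrib-+ (λ S → f (false ∷ S)) (λ S → g (false ∷ S))))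
          (interchange (∑ˢ (λ S → f (true ∷ S))) (∑ˢ (λ S → g (true ∷ S)))
                       (∑ˢ (λ S → f (false ∷ S))) (∑ˢ (λ S → g (false ∷ S))))

  ∑ˢ-distribˡ-* : ∀ {n} c (f : Subset n → ℕ) → c * ∑ˢ f ≡ ∑ˢ (λ S → c * f S)
  ∑ˢ-distribˡ-* {zero}  c f = refl
  ∑ˢ-distribˡ-* {suc n} c f =
    trans (*-distribˡ-+ c (∑ˢ (λ S → f (true ∷ S))) (∑ˢ (λ S → f (false ∷ S))))
          (cong₂ _+_ (∑ˢ-distribˡ-* c (λ S → f (true ∷ S))) (∑ˢ-distribˡ-* c (λ S → f (false ∷ S))))

  ∑ˢ-distribʳ-* : ∀ {n} c (f : Subset n → ℕ) → ∑ˢ f * c ≡ ∑ˢ (λ S → f S * c)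
  ∑ˢ-distribʳ-* c f =
    trans (*-comm (∑ˢ f) c) (trans (∑ˢ-distribˡ-* c f) (∑ˢ-cong (λ S → *-comm c (f S))))

  ∑ˢ-comm : ∀ {m n} (f : Subset m → Subset n → ℕ) →
            ∑ˢ (λ S → ∑ˢ (f S)) ≡ ∑ˢ (λ T → ∑ˢ (λ S → f S T))
  ∑ˢ-comm {zero}  f = refl
  ∑ˢ-comm {suc m} f =
    trans (cong₂ _+_ (∑ˢ-comm (λ S → f (true ∷ S))) (∑ˢ-comm (λ S → f (false ∷ S))))
          (sym (∑ˢ-distrib-+ (λ T → ∑ˢ (λ S → f (true ∷ S) T)) (λ T → ∑ˢ (λ S → f (false ∷ S) T))))

  ∑-∑ˢ-comm : ∀ {m n} (f : Fin m → Subset n → ℕ) →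
              ∑[ i < m ] ∑ˢ (f i) ≡ ∑ˢ (λ S → ∑[ i < m ] f i S)
  ∑-∑ˢ-comm {zero}  {n} f = sym (∑ˢ-zero n)
  ∑-∑ˢ-comm {suc m} f =
    trans (cong (∑ˢ (f zero) +_) (∑-∑ˢ-comm (λ i → f (suc i))))
          (sym (∑ˢ-distrib-+ (f zero) (λ S → ∑[ i < m ] f (suc i) S)))

  -- Inserting v is a bijection from the subsets avoiding v onto those containing v.
  ∑ˢ-insert : ∀ {n} (v : Fin n) (g : Subset n → ℕ) →
              ∑ˢ (λ S → χ (lookup S v) * g S) ≡ ∑ˢ (λ S → χ (not (lookup S v)) * g (S [ v ]≔ true))
  ∑ˢ-insert {suc n} zero    g = +-comm (∑ˢ (λ S → 1 * g (true ∷ S))) (∑ˢ {n} (λ _ → 0))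
  ∑ˢ-insert {suc n} (suc v) g =
    cong₂ _+_ (∑ˢ-insert v (λ S → g (true ∷ S))) (∑ˢ-insert v (λ S → g (false ∷ S)))

  countFin-∑ : ∀ {n} (p : Fin n → Bool) → countFin p ≡ ∑[ i < n ] χ (p i)
  countFin-∑ {zero}  p = refl
  countFin-∑ {suc n} p with p zero
  ... | true  = cong suc (countFin-∑ (λ i → p (suc i)))
  ... | false = countFin-∑ (λ i → p (suc i))

  ∣∣-∑ : ∀ {n} (S : Subset n) → ∣ S ∣ ≡ ∑[ i < n ] χ (lookup S i)
  ∣∣-∑ []          = refl
  ∣∣-∑ (true  ∷ S) = cong suc (∣∣-∑ S)
  ∣∣-∑ (false ∷ S) = ∣∣-∑ S

  countFin-false : ∀ n → countFin {n} (λ _ → false) ≡ 0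
  countFin-false zero    = refl
  countFin-false (suc n) = countFin-false n

  countFin-mono : ∀ {n} (p q : Fin n → Bool) → (∀ w → p w ≡ true → q w ≡ true) → countFin p ≤ countFin q
  countFin-mono {zero}  p q p⊆q = z≤n
  countFin-mono {suc n} p q p⊆q with p zero in p₀ | q zero in q₀
  ... | true  | true  = s≤s (countFin-mono _ _ (λ i → p⊆q (suc i)))
  ... | true  | false = true≢false (p⊆q zero p₀) q₀
  ... | false | true  = m≤n⇒m≤1+n (countFin-mono _ _ (λ i → p⊆q (suc i)))
  ... | false | false = countFin-mono _ _ (λ i → p⊆q (suc i))

  countFin-insert : ∀ {n} (a : Fin n → Bool) (u : Fin n) → a u ≡ false →
                    countFin (λ w → w == u ∨ a w) ≡ suc (countFin a)
  countFin-insert {suc n} a zero    a₀ rewrite a₀ = refl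
  countFin-insert {suc n} a (suc u) aᵤ with a zero
  ... | true  = cong suc (countFin-insert (λ i → a (suc i)) u aᵤ)
  ... | false = countFin-insert (λ i → a (suc i)) u aᵤ

  countFin-remove : ∀ {n} (p : Fin n → Bool) (v : Fin n) → p v ≡ true →
                    countFin p ≡ suc (countFin (λ w → not (w == v) ∧ p w))
  countFin-remove {suc n} p zero    p₀ rewrite p₀ = refl
  countFin-remove {suc n} p (suc v) pᵥ with p zero
  ... | true  = cong suc (countFin-remove (λ i → p (suc i)) v pᵥ)
  ... | false = countFin-remove (λ i → p (suc i)) v pᵥ

  countFin-mono-< : ∀ {n} (p q : Fin n → Bool) → (∀ w → p w ≡ true → q w ≡ true) →
                    (v : Fin n) → q v ≡ true → p v ≡ false → suc (countFin p) ≤ countFin q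
  countFin-mono-< p q p⊆q v qᵥ pᵥ =
    subst (suc (countFin p) ≤_) (sym (countFin-remove q v qᵥ))
          (s≤s (countFin-mono p (λ w → not (w == v) ∧ q w) p⊆q∖v))
    where
    p⊆q∖v : ∀ w → p w ≡ true → (not (w == v) ∧ q w) ≡ true
    p⊆q∖v w pw with w ≟ v
    ... | yes refl = true≢false pw pᵥ
    ... | no _     = p⊆q w pw

  -- Counting subsets T subject to independent constraints c w (T w), one per
  -- vertex: a vertex admitting both values doubles the count, a vertex
  -- admitting exactly one keeps it.
  ∑ˢ-constrained : ∀ {n} (c : Fin n → Bool → Bool) (free : Fin n → Bool) →
                   (∀ w → χ (c w true) + χ (c w false) ≡ (if free w then 2 else 1)) →
                   ∑ˢ (λ T → χ (allFin (λ w → c w (lookup T w)))) ≡ 2 ^ countFin free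
  ∑ˢ-constrained {zero}  c free h = refl
  ∑ˢ-constrained {suc n} c free h = begin
      ∑ˢ (λ T → χ (c zero true ∧ rest T)) + ∑ˢ (λ T → χ (c zero false ∧ rest T))
    ≡⟨ cong₂ _+_ (∑ˢ-cong (λ T → χ-∧ (c zero true) (rest T)))
                 (∑ˢ-cong (λ T → χ-∧ (c zero false) (rest T))) ⟩
      ∑ˢ (λ T → χ (c zero true) * χ (rest T)) + ∑ˢ (λ T → χ (c zero false) * χ (rest T))
    ≡⟨ sym (cong₂ _+_ (∑ˢ-distribˡ-* (χ (c zero true)) (χ ∘ rest))
                      (∑ˢ-distribˡ-* (χ (c zero false)) (χ ∘ rest))) ⟩
      χ (c zero true) * ∑ˢ (χ ∘ rest) + χ (c zero false) * ∑ˢ (χ ∘ rest)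
    ≡⟨ sym (*-distribʳ-+ (∑ˢ (χ ∘ rest)) (χ (c zero true)) (χ (c zero false))) ⟩
      (χ (c zero true) + χ (c zero false)) * ∑ˢ (χ ∘ rest)
    ≡⟨ cong₂ _*_ (h zero) (∑ˢ-constrained (λ i → c (suc i)) (λ i → free (suc i)) (λ i → h (suc i))) ⟩
      (if free zero then 2 else 1) * 2 ^ countFin (λ i → free (suc i))
    ≡⟨ double-or-keep (free zero) (countFin (λ i → free (suc i))) ⟩
      2 ^ countFin free
    ∎
    where
    open ≡-Reasoning
    rest : Subset n → Bool
    rest T = allFin (λ i → c (suc i) (lookup T i))
    double-or-keep : ∀ b k → (if b then 2 else 1) * 2 ^ k ≡ 2 ^ ((if b then 1 else 0) + k)
    double-or-keep true  k = refl
    double-or-keep false k = *-identityˡ (2 ^ k)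

  ∑ˢ-forced : ∀ {n} (c : Fin n → Bool → Bool) → (∀ w → χ (c w true) + χ (c w false) ≡ 1) →
              ∑ˢ (λ T → χ (allFin (λ w → c w (lookup T w)))) ≡ 1
  ∑ˢ-forced {n} c h = trans (∑ˢ-constrained c (λ _ → false) h) (cong (2 ^_) (countFin-false n))

  allFin-elim : ∀ {n} (f : Fin n → Bool) → allFin f ≡ true → ∀ i → f i ≡ true
  allFin-elim {suc n} f all i with f zero in f₀
  allFin-elim {suc n} f all zero    | true = f₀
  allFin-elim {suc n} f all (suc i) | true = allFin-elim (λ j → f (suc j)) all i

  allFin-intro : ∀ {n} (f : Fin n → Bool) → (∀ i → f i ≡ true) → allFin f ≡ true
  allFin-intro {zero}  f h = refl
  allFin-intro {suc n} f h rewrite h zero = allFin-intro (λ j → f (suc j)) (λ j → h (suc j))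

  allFin-false : ∀ {n} (f : Fin n → Bool) → allFin f ≡ false → ∃[ i ] f i ≡ false
  allFin-false {suc n} f all with f zero in f₀
  ... | false = zero , f₀
  ... | true with allFin-false (λ j → f (suc j)) all
  ...   | i , fᵢ = suc i , fᵢ

  allFin-∧ : ∀ {n} (f g : Fin n → Bool) → allFin (λ i → f i ∧ g i) ≡ allFin f ∧ allFin g
  allFin-∧ {zero}  f g = refl
  allFin-∧ {suc n} f g with f zero | g zero
  ... | true  | true  = allFin-∧ (λ i → f (suc i)) (λ i → g (suc i))
  ... | true  | false = sym (∧-zeroʳ (allFin (λ i → f (suc i))))
  ... | false | _     = refl

  anyFin-true : ∀ {n} (f : Fin n → Bool) → anyFin f ≡ true → ∃[ i ] f i ≡ true
  anyFin-true {suc n} f any with f zero in f₀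
  ... | true  = zero , f₀
  ... | false with anyFin-true (λ j → f (suc j)) any
  ...   | i , fᵢ = suc i , fᵢ

  anyFin-intro : ∀ {n} (f : Fin n → Bool) (i : Fin n) → f i ≡ true → anyFin f ≡ true
  anyFin-intro {suc n} f zero    fᵢ rewrite fᵢ = refl
  anyFin-intro {suc n} f (suc i) fᵢ with f zero
  ... | true  = refl
  ... | false = anyFin-intro (λ j → f (suc j)) i fᵢ

  sum-filter : ∀ {A : Set} {P : Pred A 0ℓ} (P? : Decidable P) (g : A → ℕ) (xs : List A) →
               List.sum (map g (filter P? xs)) ≡ List.sum (map (λ x → χ (does (P? x)) * g x) xs)
  sum-filter P? g []       = refl
  sum-filter P? g (x ∷ xs) with does (P? x)
  ... | true  = cong₂ _+_ (sym (*-identityˡ (g x))) (sum-filter P? g xs)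
  ... | false = sum-filter P? g xs

  sum-allSubsets : ∀ n (f : Subset n → ℕ) → List.sum (map f (allSubsets n)) ≡ ∑ˢ f
  sum-allSubsets zero    f = +-identityʳ (f [])
  sum-allSubsets (suc n) f = begin
      List.sum (map f (map (true ∷_) xs ++ map (false ∷_) xs))
    ≡⟨ cong List.sum (map-++ f (map (true ∷_) xs) (map (false ∷_) xs)) ⟩
      List.sum (map f (map (true ∷_) xs) ++ map f (map (false ∷_) xs))
    ≡⟨ sum-++ (map f (map (true ∷_) xs)) (map f (map (false ∷_) xs)) ⟩
      List.sum (map f (map (true ∷_) xs)) + List.sum (map f (map (false ∷_) xs))
    ≡⟨ cong₂ (λ ys zs → List.sum ys + List.sum zs) (sym (map-∘ xs)) (sym (map-∘ xs)) ⟩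
      List.sum (map (λ S → f (true ∷ S)) xs) + List.sum (map (λ S → f (false ∷ S)) xs)
    ≡⟨ cong₂ _+_ (sum-allSubsets n (λ S → f (true ∷ S))) (sum-allSubsets n (λ S → f (false ∷ S))) ⟩
      ∑ˢ f
    ∎
    where
    open ≡-Reasoning
    xs : List (Subset n)
    xs = allSubsets n

  length-as-sum : ∀ {A : Set} (xs : List A) → length xs ≡ List.sum (map (λ _ → 1) xs)
  length-as-sum []       = refl
  length-as-sum (x ∷ xs) = cong suc (length-as-sum xs)

  module Domination {n : ℕ} (G : Graph n) where

    N[_] : Fin n → Fin n → Bool
    N[ x ] w = (w == x) ∨ adj G x w

    N[]-self : ∀ x → N[ x ] x ≡ true
    N[]-self x rewrite ==-refl x = refl

    N[]-adj : ∀ x w → adj G x w ≡ true → N[ x ] w ≡ true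
    N[]-adj x w a rewrite a = ∨-zeroʳ (w == x)

    dom : Subset n → Bool
    dom = isDominating G

    dom? : (S : Subset n) → Dec (dom S ≡ true)
    dom? S = dom S Bool.≟ true

    dominatedBy : Subset n → Fin n → Bool
    dominatedBy S x = lookup S x ∨ anyFin (λ w → lookup S w ∧ adj G x w)

    dominated⇒witness : ∀ S x → dominatedBy S x ≡ true → ∃[ w ] lookup S w ≡ true × N[ x ] w ≡ true
    dominated⇒witness S x d with lookup S x in Sₓ
    ... | true  = x , Sₓ , N[]-self x
    ... | false with anyFin-true (λ w → lookup S w ∧ adj G x w) d
    ...   | w , Sw∧a = w , ∧-conicalˡ _ _ Sw∧a , N[]-adj x w (∧-conicalʳ (lookup S w) _ Sw∧a)

    witness⇒dominated : ∀ S x w → lookup S w ≡ true → N[ x ] w ≡ true → dominatedBy S x ≡ true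
    witness⇒dominated S x w Sw Nw with w ≟ x
    ... | yes refl rewrite Sw = refl
    ... | no _ = trans (cong (lookup S x ∨_) (anyFin-intro _ w (trans (cong (_∧ adj G x w) Sw) Nw)))
                       (∨-zeroʳ (lookup S x))

    dom-mono : ∀ S T → dom S ≡ true → (∀ w → lookup S w ≡ true → lookup T w ≡ true) → dom T ≡ true
    dom-mono S T domS S⊆T = allFin-intro (dominatedBy T) dominatedByT
      where
      dominatedByT : ∀ x → dominatedBy T x ≡ true
      dominatedByT x with dominated⇒witness S x (allFin-elim (dominatedBy S) domS x)
      ... | w , Sw , Nw = witness⇒dominated T x w (S⊆T w Sw) Nw

    privateNbr : Fin n → Fin n → Subset n → Bool
    privateNbr u v S = lookup S v ∧ N[ u ] v ∧ allFin (λ w → not (lookup S w ∧ N[ u ] w) ∨ (w == v))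

    privateNbr-intro : ∀ u v S → lookup S v ≡ true → N[ u ] v ≡ true →
                       (∀ w → lookup S w ≡ true → N[ u ] w ≡ true → w ≡ v) → privateNbr u v S ≡ true
    privateNbr-intro u v S Sv Nv only rewrite Sv | Nv = allFin-intro _ onlyᵇ
      where
      onlyᵇ : ∀ w → (not (lookup S w ∧ N[ u ] w) ∨ (w == v)) ≡ true
      onlyᵇ w with lookup S w in Sw | N[ u ] w in Nw
      ... | true  | true  rewrite only w Sw Nw = ==-refl v
      ... | true  | false = refl
      ... | false | _     = refl

    privateNbr-member : ∀ u v S → privateNbr u v S ≡ true → lookup S v ≡ true
    privateNbr-member u v S p = ∧-conicalˡ _ _ p

    privateNbr-nbr : ∀ u v S → privateNbr u v S ≡ true → N[ u ] v ≡ true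
    privateNbr-nbr u v S p = ∧-conicalˡ _ _ (∧-conicalʳ (lookup S v) _ p)

    privateNbr-only : ∀ u v S → privateNbr u v S ≡ true →
                      ∀ w → lookup S w ≡ true → N[ u ] w ≡ true → w ≡ v
    privateNbr-only u v S p w Sw Nw =
      does⇒proof (w ≟ v) (subst (λ b → (not b ∨ (w == v)) ≡ true) (cong₂ _∧_ Sw Nw)
                   (allFin-elim _ (∧-conicalʳ (N[ u ] v) _ (∧-conicalʳ (lookup S v) _ p)) w))

    -- The critical step: if v ∉ S, S is not dominating but S ∪ {v} is, then
    -- some vertex u (one not dominated by S) is a private neighbour of v
    -- with respect to S ∪ {v}.
    privateNbr-exists : ∀ S v → lookup S v ≡ false → dom S ≡ false → dom (S [ v ]≔ true) ≡ true →
                        ∃[ u ] privateNbr u v (S [ v ]≔ true) ≡ true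
    privateNbr-exists S v Sv domS domS⁺ = u , privateNbr-intro u v S⁺ (lookup∘update v S true) Nv only
      where
      S⁺ : Subset n
      S⁺ = S [ v ]≔ true
      u : Fin n
      u = proj₁ (allFin-false (dominatedBy S) domS)
      u-undominated : dominatedBy S u ≡ false
      u-undominated = proj₂ (allFin-false (dominatedBy S) domS)
      S-misses-N[u] : ∀ w → lookup S w ≡ true → N[ u ] w ≡ false
      S-misses-N[u] w Sw with N[ u ] w in Nw
      ... | false = refl
      ... | true  = true≢false (witness⇒dominated S u w Sw Nw) u-undominated
      only : ∀ w → lookup S⁺ w ≡ true → N[ u ] w ≡ true → w ≡ v
      only w S⁺w Nw with w ≟ v
      ... | yes w≡v = w≡v
      ... | no w≢v  = true≢false Nw (S-misses-N[u] w (trans (sym (lookup∘update′ w≢v S true)) S⁺w))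
      Nv : N[ u ] v ≡ true
      Nv with dominated⇒witness S⁺ u (allFin-elim (dominatedBy S⁺) domS⁺ u)
      ... | w , S⁺w , Nw = subst (λ x → N[ u ] x ≡ true) (only w S⁺w Nw) Nw

    nDom : ℕ
    nDom = ∑ˢ (λ S → χ (dom S))

    nDomWith nDomWithout : Fin n → ℕ
    nDomWith    v = ∑ˢ (λ S → χ (dom S ∧ lookup S v))
    nDomWithout v = ∑ˢ (λ S → χ (dom S ∧ not (lookup S v)))

    nPrivate : Fin n → Fin n → ℕ
    nPrivate u v = ∑ˢ (λ S → χ (dom S ∧ privateNbr u v S))

    nPrivateFrom : Fin n → ℕ
    nPrivateFrom u = ∑[ v < n ] nPrivate u v

    nDomWith+nDomWithout : ∀ v → nDomWith v + nDomWithout v ≡ nDom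
    nDomWith+nDomWithout v =
      trans (sym (∑ˢ-distrib-+ (λ S → χ (dom S ∧ lookup S v)) (λ S → χ (dom S ∧ not (lookup S v)))))
            (∑ˢ-cong (λ S → sym (χ-split (dom S) (lookup S v))))

    -- The dominating sets in which u is a private neighbour of v all contain v,
    -- so they are counted by removing v from them.
    nPrivate-insert : ∀ u v → nPrivate u v ≡
      ∑ˢ (λ S → χ (not (lookup S v)) * χ (dom (S [ v ]≔ true) ∧ privateNbr u v (S [ v ]≔ true)))
    nPrivate-insert u v =
      trans (∑ˢ-cong containsV) (∑ˢ-insert v (λ S → χ (dom S ∧ privateNbr u v S)))
      where
      containsV : ∀ S → χ (dom S ∧ privateNbr u v S) ≡ χ (lookup S v) * χ (dom S ∧ privateNbr u v S)
      containsV S with lookup S v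
      ... | true  = sym (*-identityˡ _)
      ... | false = cong χ (∧-zeroʳ (dom S))

    -- Step (1): if inserting v into a set S ∌ v gives a dominating set, then
    -- S is dominating or some u is a private neighbour of v with respect to
    -- S ∪ {v} (privateNbr-exists); counting both cases:
    nDomWith-bound : ∀ v → nDomWith v ≤ nDomWithout v + ∑[ u < n ] nPrivate u v
    nDomWith-bound v = begin
        nDomWith v
      ≡⟨ ∑ˢ-cong (λ S → trans (cong χ (∧-comm (dom S) (lookup S v))) (χ-∧ (lookup S v) (dom S))) ⟩
        ∑ˢ (λ S → χ (lookup S v) * χ (dom S))
      ≡⟨ ∑ˢ-insert v (λ S → χ (dom S)) ⟩
        ∑ˢ (λ S → χ (not (lookup S v)) * χ (dom (S⁺ S)))
      ≤⟨ ∑ˢ-mono insertion ⟩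
        ∑ˢ (λ S → χ (dom S ∧ not (lookup S v)) + ∑[ u < n ] private⁺ u S)
      ≡⟨ ∑ˢ-distrib-+ (λ S → χ (dom S ∧ not (lookup S v))) (λ S → ∑[ u < n ] private⁺ u S) ⟩
        nDomWithout v + ∑ˢ (λ S → ∑[ u < n ] private⁺ u S)
      ≡⟨ cong (nDomWithout v +_) (sym (∑-∑ˢ-comm private⁺)) ⟩
        nDomWithout v + ∑[ u < n ] ∑ˢ (private⁺ u)
      ≡⟨ cong (nDomWithout v +_) (sum-cong-≗ (λ u → sym (nPrivate-insert u v))) ⟩
        nDomWithout v + ∑[ u < n ] nPrivate u v
      ∎
      where
      open ≤-Reasoning
      S⁺ : Subset n → Subset n
      S⁺ S = S [ v ]≔ true
      private⁺ : Fin n → Subset n → ℕ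
      private⁺ u S = χ (not (lookup S v)) * χ (dom (S⁺ S) ∧ privateNbr u v (S⁺ S))
      insertion : ∀ S → χ (not (lookup S v)) * χ (dom (S⁺ S)) ≤
                        χ (dom S ∧ not (lookup S v)) + ∑[ u < n ] private⁺ u S
      insertion S with lookup S v in Sv | dom (S⁺ S) in domS⁺ | dom S in domS
      ... | true  | _     | _     = z≤n
      ... | false | false | _     = z≤n
      ... | false | true  | true  = s≤s z≤n
      ... | false | true  | false with privateNbr-exists S v Sv domS domS⁺
      ...   | u , isPrivate = ≤-trans (≤-reflexive (cong (λ b → 1 * χ b) (sym isPrivate)))
                                      (∑-term (λ u → 1 * χ (privateNbr u v (S⁺ S))) u)

    twice-nDomWith : ∀ v → 2 * nDomWith v ≤ nDom + ∑[ u < n ] nPrivate u v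
    twice-nDomWith v = begin
        2 * nDomWith v
      ≡⟨ cong (nDomWith v +_) (+-identityʳ (nDomWith v)) ⟩
        nDomWith v + nDomWith v
      ≤⟨ +-monoʳ-≤ (nDomWith v) (nDomWith-bound v) ⟩
        nDomWith v + (nDomWithout v + ∑[ u < n ] nPrivate u v)
      ≡⟨ sym (+-assoc (nDomWith v) (nDomWithout v) _) ⟩
        nDomWith v + nDomWithout v + ∑[ u < n ] nPrivate u v
      ≡⟨ cong (_+ ∑[ u < n ] nPrivate u v) (nDomWith+nDomWithout v) ⟩
        nDom + ∑[ u < n ] nPrivate u v
      ∎
      where open ≤-Reasoning

    totalSize : ℕ
    totalSize = ∑ˢ (λ S → χ (dom S) * ∣ S ∣)

    totalSize-∑ : totalSize ≡ ∑[ v < n ] nDomWith v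
    totalSize-∑ = begin
        ∑ˢ (λ S → χ (dom S) * ∣ S ∣)
      ≡⟨ ∑ˢ-cong sizeAsSum ⟩
        ∑ˢ (λ S → ∑[ v < n ] χ (dom S ∧ lookup S v))
      ≡⟨ sym (∑-∑ˢ-comm (λ v S → χ (dom S ∧ lookup S v))) ⟩
        ∑[ v < n ] nDomWith v
      ∎
      where
      open ≡-Reasoning
      sizeAsSum : ∀ S → χ (dom S) * ∣ S ∣ ≡ ∑[ v < n ] χ (dom S ∧ lookup S v)
      sizeAsSum S = begin
          χ (dom S) * ∣ S ∣
        ≡⟨ cong (χ (dom S) *_) (∣∣-∑ S) ⟩
          χ (dom S) * ∑[ v < n ] χ (lookup S v)
        ≡⟨ *-distribˡ-sum (χ (dom S)) (λ v → χ (lookup S v)) ⟩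
          ∑[ v < n ] (χ (dom S) * χ (lookup S v))
        ≡⟨ sum-cong-≗ (λ v → sym (χ-∧ (dom S) (lookup S v))) ⟩
          ∑[ v < n ] χ (dom S ∧ lookup S v)
        ∎

    twice-totalSize : 2 * totalSize ≤ n * nDom + ∑[ u < n ] nPrivateFrom u
    twice-totalSize = begin
        2 * totalSize
      ≡⟨ cong (2 *_) totalSize-∑ ⟩
        2 * ∑[ v < n ] nDomWith v
      ≡⟨ *-distribˡ-sum 2 nDomWith ⟩
        ∑[ v < n ] (2 * nDomWith v)
      ≤⟨ ∑-mono twice-nDomWith ⟩
        ∑[ v < n ] (nDom + ∑[ u < n ] nPrivate u v)
      ≡⟨ ∑-distrib-+ (λ _ → nDom) (λ v → ∑[ u < n ] nPrivate u v) ⟩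
        ∑[ v < n ] nDom + ∑[ v < n ] ∑[ u < n ] nPrivate u v
      ≡⟨ cong₂ _+_ (∑-const n nDom) (∑-comm (λ v u → nPrivate u v)) ⟩
        n * nDom + ∑[ u < n ] nPrivateFrom u
      ∎
      where open ≤-Reasoning

    length-dominatingSets : length (dominatingSets G) ≡ nDom
    length-dominatingSets = begin
        length (dominatingSets G)
      ≡⟨ length-as-sum (dominatingSets G) ⟩
        List.sum (map (λ _ → 1) (dominatingSets G))
      ≡⟨ sum-filter dom? (λ _ → 1) (allSubsets n) ⟩
        List.sum (map (λ S → χ (does (dom? S)) * 1) (allSubsets n))
      ≡⟨ sum-allSubsets n (λ S → χ (does (dom? S)) * 1) ⟩
        ∑ˢ (λ S → χ (does (dom? S)) * 1)
      ≡⟨ ∑ˢ-cong (λ S → trans (*-identityʳ _) (cong χ (does-≟-true (dom S)))) ⟩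
        nDom
      ∎
      where open ≡-Reasoning

    sum-dominatingSets : List.sum (map ∣_∣ (dominatingSets G)) ≡ totalSize
    sum-dominatingSets = begin
        List.sum (map ∣_∣ (dominatingSets G))
      ≡⟨ sum-filter dom? ∣_∣ (allSubsets n) ⟩
        List.sum (map (λ S → χ (does (dom? S)) * ∣ S ∣) (allSubsets n))
      ≡⟨ sum-allSubsets n (λ S → χ (does (dom? S)) * ∣ S ∣) ⟩
        ∑ˢ (λ S → χ (does (dom? S)) * ∣ S ∣)
      ≡⟨ ∑ˢ-cong (λ S → cong (λ b → χ b * ∣ S ∣) (does-≟-true (dom S))) ⟩
        totalSize
      ∎
      where open ≡-Reasoning

    avd-as-ratio : frac totalSize nDom ≡ avd G
    avd-as-ratio = sym (cong₂ frac sum-dominatingSets length-dominatingSets)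

    -- A dominating S in which u is a private neighbour of v (so S ∩ N[u] = {v})
    -- extends in 2^d − 1 ways to a set T that agrees with S outside N[u],
    -- contains v, and does not cover N[u].  Every such T is dominating, the
    -- pair (T, v) determines S, and v ranges over the at most d vertices of
    -- T ∩ N[u].
    module PrivateNeighbourBound (u : Fin n) where

      d : ℕ
      d = deg G u

      |N[u]| : countFin N[ u ] ≡ suc d
      |N[u]| = countFin-insert (adj G u) u (irrefl G u)

      covers : Subset n → Bool
      covers T = allFin (λ w → not (N[ u ] w) ∨ lookup T w)

      -- The constraint on w ∈ T for T to extend S at v: inside N[u] only v is
      -- forced into T, outside N[u] the set T agrees with S.
      extendsAt : Fin n → Subset n → Fin n → Bool → Bool
      extendsAt v S w b = if N[ u ] w then not (w == v) ∨ b else does (b Bool.≟ lookup S w)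

      extends : Fin n → Subset n → Subset n → Bool
      extends v S T = allFin (λ w → extendsAt v S w (lookup T w))

      extendsAt-inside : ∀ v S {w b} → N[ u ] w ≡ true → extendsAt v S w b ≡ (not (w == v) ∨ b)
      extendsAt-inside v S Nw rewrite Nw = refl

      extendsAt-outside : ∀ v S {w b} → N[ u ] w ≡ false → extendsAt v S w b ≡ does (b Bool.≟ lookup S w)
      extendsAt-outside v S Nw rewrite Nw = refl

      -- For v ∈ N[u] the d vertices of N[u] ∖ {v} are free: 2^d extensions.
      #extensions : ∀ v S → N[ u ] v ≡ true → ∑ˢ (λ T → χ (extends v S T)) ≡ 2 ^ d
      #extensions v S Nv =
        trans (∑ˢ-constrained (extendsAt v S) (λ w → not (w == v) ∧ N[ u ] w) choices)
              (cong (2 ^_) (suc-injective (trans (sym (countFin-remove N[ u ] v Nv)) |N[u]|)))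
        where
        choices : ∀ w → χ (extendsAt v S w true) + χ (extendsAt v S w false) ≡
                        (if not (w == v) ∧ N[ u ] w then 2 else 1)
        choices w with N[ u ] w | w == v | lookup S w
        ... | true  | true  | _     = refl
        ... | true  | false | _     = refl
        ... | false | true  | true  = refl
        ... | false | true  | false = refl
        ... | false | false | true  = refl
        ... | false | false | false = refl

      #covering-extensions : ∀ v S → ∑ˢ (λ T → χ (extends v S T ∧ covers T)) ≡ 1
      #covering-extensions v S =
        trans (∑ˢ-cong (λ T → cong χ (sym (allFin-∧ (λ w → extendsAt v S w (lookup T w))
                                                    (λ w → not (N[ u ] w) ∨ lookup T w)))))
              (∑ˢ-forced (λ w b → extendsAt v S w b ∧ (not (N[ u ] w) ∨ b)) choices)
        where
        choices : ∀ w → χ (extendsAt v S w true ∧ (not (N[ u ] w) ∨ true)) +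
                        χ (extendsAt v S w false ∧ (not (N[ u ] w) ∨ false)) ≡ 1
        choices w with N[ u ] w | w == v | lookup S w
        ... | true  | true  | _     = refl
        ... | true  | false | _     = refl
        ... | false | _     | true  = refl
        ... | false | _     | false = refl

      #partial-extensions : ∀ v S → N[ u ] v ≡ true →
                            ∑ˢ (λ T → χ (extends v S T ∧ not (covers T))) ≡ 2 ^ d ∸ 1
      #partial-extensions v S Nv = trans (sym (m+n∸m≡n 1 partial)) (cong (_∸ 1) covering+partial)
        where
        open ≡-Reasoning
        partial : ℕ
        partial = ∑ˢ (λ T → χ (extends v S T ∧ not (covers T)))
        covering+partial : 1 + partial ≡ 2 ^ d
        covering+partial = begin
            1 + partial
          ≡⟨ cong (_+ partial) (sym (#covering-extensions v S)) ⟩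
            ∑ˢ (λ T → χ (extends v S T ∧ covers T)) + partial
          ≡⟨ sym (∑ˢ-distrib-+ (λ T → χ (extends v S T ∧ covers T))
                               (λ T → χ (extends v S T ∧ not (covers T)))) ⟩
            ∑ˢ (λ T → χ (extends v S T ∧ covers T) + χ (extends v S T ∧ not (covers T)))
          ≡⟨ ∑ˢ-cong (λ T → sym (χ-split (extends v S T) (covers T))) ⟩
            ∑ˢ (λ T → χ (extends v S T))
          ≡⟨ #extensions v S Nv ⟩
            2 ^ d
          ∎

      extension-∋ : ∀ v S T → extends v S T ≡ true → N[ u ] v ≡ true → lookup T v ≡ true
      extension-∋ v S T e Nv =
        subst (λ b → (not b ∨ lookup T v) ≡ true) (==-refl v)
              (trans (sym (extendsAt-inside v S Nv)) (allFin-elim _ e v))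

      extension-⊇ : ∀ v S T → privateNbr u v S ≡ true → extends v S T ≡ true →
                    ∀ w → lookup S w ≡ true → lookup T w ≡ true
      extension-⊇ v S T p e w Sw with N[ u ] w in Nw
      ... | true  rewrite privateNbr-only u v S p w Sw Nw = extension-∋ v S T e (privateNbr-nbr u v S p)
      ... | false = trans (does⇒proof (lookup T w Bool.≟ lookup S w)
                                      (trans (sym (extendsAt-outside v S Nw)) (allFin-elim _ e w))) Sw

      -- (T, v) is hit by the extension map: T is dominating, does not cover
      -- N[u], and v ∈ T ∩ N[u].
      inImage : Fin n → Subset n → ℕ
      inImage v T = χ (dom T ∧ not (covers T)) * χ (lookup T v ∧ N[ u ] v)

      extension-inImage : ∀ v S T →
        χ (dom S ∧ privateNbr u v S) * χ (extends v S T ∧ not (covers T)) ≤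
        χ (privateNbr u v S ∧ extends v S T) * inImage v T
      extension-inImage v S T with dom S in domS | privateNbr u v S in p | extends v S T in e | covers T
      ... | false | _     | _     | _     = z≤n
      ... | true  | false | _     | _     = z≤n
      ... | true  | true  | false | _     = z≤n
      ... | true  | true  | true  | true  = z≤n
      ... | true  | true  | true  | false
            rewrite dom-mono S T domS (extension-⊇ v S T p e)
                  | extension-∋ v S T e (privateNbr-nbr u v S p)
                  | privateNbr-nbr u v S p = ≤-refl

      -- S is recovered from T and v: it is T outside N[u] and {v} inside.
      recovered : Fin n → Subset n → Fin n → Bool
      recovered v T w = if N[ u ] w then w == v else lookup T w

      recovered-correct : ∀ v S T → privateNbr u v S ≡ true → extends v S T ≡ true →
                          ∀ w → lookup S w ≡ recovered v T w
      recovered-correct v S T p e w with N[ u ] w in Nw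
      ... | false = sym (does⇒proof (lookup T w Bool.≟ lookup S w)
                                    (trans (sym (extendsAt-outside v S Nw)) (allFin-elim _ e w)))
      ... | true with w ≟ v
      ...   | yes refl = privateNbr-member u v S p
      ...   | no w≢v with lookup S w in Sw
      ...     | false = refl
      ...     | true  = contradiction (privateNbr-only u v S p w Sw Nw) w≢v

      at-most-one-preimage : ∀ v T → ∑ˢ (λ S → χ (privateNbr u v S ∧ extends v S T)) ≤ 1
      at-most-one-preimage v T = begin
          ∑ˢ (λ S → χ (privateNbr u v S ∧ extends v S T))
        ≤⟨ ∑ˢ-mono pinned ⟩
          ∑ˢ (λ S → χ (allFin (λ w → does (lookup S w Bool.≟ recovered v T w))))
        ≡⟨ ∑ˢ-forced (λ w b → does (b Bool.≟ recovered v T w)) (λ w → one-of-two (recovered v T w)) ⟩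
          1
        ∎
        where
        open ≤-Reasoning
        pinned : ∀ S → χ (privateNbr u v S ∧ extends v S T) ≤
                       χ (allFin (λ w → does (lookup S w Bool.≟ recovered v T w)))
        pinned S with privateNbr u v S in p | extends v S T in e
        ... | false | _     = z≤n
        ... | true  | false = z≤n
        ... | true  | true  rewrite allFin-intro (λ w → does (lookup S w Bool.≟ recovered v T w))
                                    (λ w → dec-true (lookup S w Bool.≟ recovered v T w)
                                                    (recovered-correct v S T p e w)) = ≤-refl

      nPrivate-bound : ∀ v → nPrivate u v * (2 ^ d ∸ 1) ≤ ∑ˢ (inImage v)
      nPrivate-bound v = begin
          nPrivate u v * (2 ^ d ∸ 1)
        ≡⟨ ∑ˢ-distribʳ-* (2 ^ d ∸ 1) (λ S → χ (dom S ∧ privateNbr u v S)) ⟩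
          ∑ˢ (λ S → χ (dom S ∧ privateNbr u v S) * (2 ^ d ∸ 1))
        ≡⟨ ∑ˢ-cong count-extensions ⟩
          ∑ˢ (λ S → χ (dom S ∧ privateNbr u v S) * ∑ˢ (partial S))
        ≡⟨ ∑ˢ-cong (λ S → ∑ˢ-distribˡ-* (χ (dom S ∧ privateNbr u v S)) (partial S)) ⟩
          ∑ˢ (λ S → ∑ˢ (λ T → χ (dom S ∧ privateNbr u v S) * partial S T))
        ≤⟨ ∑ˢ-mono (λ S → ∑ˢ-mono (extension-inImage v S)) ⟩
          ∑ˢ (λ S → ∑ˢ (λ T → χ (privateNbr u v S ∧ extends v S T) * inImage v T))
        ≡⟨ ∑ˢ-comm (λ S T → χ (privateNbr u v S ∧ extends v S T) * inImage v T) ⟩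
          ∑ˢ (λ T → ∑ˢ (λ S → χ (privateNbr u v S ∧ extends v S T) * inImage v T))
        ≡⟨ ∑ˢ-cong (λ T → sym (∑ˢ-distribʳ-* (inImage v T)
                                             (λ S → χ (privateNbr u v S ∧ extends v S T)))) ⟩
          ∑ˢ (λ T → ∑ˢ (λ S → χ (privateNbr u v S ∧ extends v S T)) * inImage v T)
        ≤⟨ ∑ˢ-mono (λ T → *-monoˡ-≤ (inImage v T) (at-most-one-preimage v T)) ⟩
          ∑ˢ (λ T → 1 * inImage v T)
        ≡⟨ ∑ˢ-cong (λ T → *-identityˡ (inImage v T)) ⟩
          ∑ˢ (inImage v)
        ∎
        where
        open ≤-Reasoning
        partial : Subset n → Subset n → ℕ
        partial S T = χ (extends v S T ∧ not (covers T))
        count-extensions : ∀ S → χ (dom S ∧ privateNbr u v S) * (2 ^ d ∸ 1) ≡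
                                 χ (dom S ∧ privateNbr u v S) * ∑ˢ (partial S)
        count-extensions S = χ-weighted (dom S ∧ privateNbr u v S) λ domS∧p →
          sym (#partial-extensions v S (privateNbr-nbr u v S (∧-conicalʳ (dom S) _ domS∧p)))

      -- A set that does not cover N[u] meets it in at most d vertices.
      inImage-bound : ∀ T → ∑[ v < n ] inImage v T ≤ d * χ (dom T)
      inImage-bound T = begin
          ∑[ v < n ] inImage v T
        ≡⟨ sym (*-distribˡ-sum (χ (dom T ∧ not (covers T))) (λ v → χ (lookup T v ∧ N[ u ] v))) ⟩
          χ (dom T ∧ not (covers T)) * ∑[ v < n ] χ (lookup T v ∧ N[ u ] v)
        ≡⟨ cong (χ (dom T ∧ not (covers T)) *_) (sym (countFin-∑ (λ v → lookup T v ∧ N[ u ] v))) ⟩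
          χ (dom T ∧ not (covers T)) * countFin (λ v → lookup T v ∧ N[ u ] v)
        ≤⟨ bound ⟩
          d * χ (dom T)
        ∎
        where
        open ≤-Reasoning
        bound : χ (dom T ∧ not (covers T)) * countFin (λ v → lookup T v ∧ N[ u ] v) ≤ d * χ (dom T)
        bound with dom T | covers T in c
        ... | false | _     = z≤n
        ... | true  | true  = z≤n
        ... | true  | false with allFin-false (λ w → not (N[ u ] w) ∨ lookup T w) c
        ...   | w , uncovered = begin
            1 * countFin (λ v → lookup T v ∧ N[ u ] v)
          ≡⟨ *-identityˡ _ ⟩
            countFin (λ v → lookup T v ∧ N[ u ] v)
          ≤⟨ ≤-pred (≤-trans (countFin-mono-< _ N[ u ] (λ v → ∧-conicalʳ (lookup T v) _) w Nw T∌w)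
                             (≤-reflexive |N[u]|)) ⟩
            d
          ≡⟨ sym (*-identityʳ d) ⟩
            d * 1
          ∎
          where
          Nw : N[ u ] w ≡ true
          Nw = not-injective (∨-conicalˡ _ _ uncovered)
          T∌w : (lookup T w ∧ N[ u ] w) ≡ false
          T∌w rewrite ∨-conicalʳ (not (N[ u ] w)) _ uncovered = refl

      private-neighbour-bound : nPrivateFrom u * (2 ^ d ∸ 1) ≤ d * nDom
      private-neighbour-bound = begin
          nPrivateFrom u * (2 ^ d ∸ 1)
        ≡⟨ *-distribʳ-sum (2 ^ d ∸ 1) (nPrivate u) ⟩
          ∑[ v < n ] (nPrivate u v * (2 ^ d ∸ 1))
        ≤⟨ ∑-mono nPrivate-bound ⟩
          ∑[ v < n ] ∑ˢ (inImage v)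
        ≡⟨ ∑-∑ˢ-comm inImage ⟩
          ∑ˢ (λ T → ∑[ v < n ] inImage v T)
        ≤⟨ ∑ˢ-mono inImage-bound ⟩
          ∑ˢ (λ T → d * χ (dom T))
        ≡⟨ sym (∑ˢ-distribˡ-* d (λ T → χ (dom T))) ⟩
          d * nDom
        ∎
        where open ≤-Reasoning

module Arithmetic where

  open import Data.Nat using (zero; suc; _+_; _*_; _∸_; _^_; _≤_; _<_; z≤n; s≤s)
  open import Data.Nat.Properties
  open import Data.Fin using (Fin; zero; suc)
  import Data.Integer as ℤ
  import Data.Integer.Properties as ℤ
  open import Data.Rational as ℚ using (ℚ; 0ℚ; toℚᵘ)
  import Data.Rational.Properties as ℚ
  open import Data.Rational.Unnormalised as ℚᵘ using (mkℚᵘ; *≤*) renaming (_≃_ to _≃ᵘ_)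
  import Data.Rational.Unnormalised.Properties as ℚᵘ
  open import Relation.Binary.PropositionalEquality
  open import Relation.Nullary using (¬_)
  open import Algebra.Properties.CommutativeSemigroup *-commutativeSemigroup
    using () renaming (x∙yz≈y∙xz to *-left-comm)
  open import Algebra.Properties.Semiring.Sum +-*-semiring using (sum-syntax) renaming (sum to ∑)

  frac-≃ : ∀ a b → toℚᵘ (frac a (suc b)) ≃ᵘ mkℚᵘ (ℤ.+ a) b
  frac-≃ a b = ℚ.toℚᵘ-fromℚᵘ (mkℚᵘ (ℤ.+ a) b)

  frac-≤ : ∀ a b c e → 0 < b → 0 < e → a * e ≤ c * b → frac a b ℚ.≤ frac c e
  frac-≤ a (suc b) c (suc e) _ _ cross = ℚ.toℚᵘ-cancel-≤ (begin
      toℚᵘ (frac a (suc b))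
    ≃⟨ frac-≃ a b ⟩
      mkℚᵘ (ℤ.+ a) b
    ≤⟨ *≤* (subst₂ ℤ._≤_ (ℤ.pos-* a (suc e)) (ℤ.pos-* c (suc b)) (ℤ.+≤+ cross)) ⟩
      mkℚᵘ (ℤ.+ c) e
    ≃⟨ ℚᵘ.≃-sym (frac-≃ c e) ⟩
      toℚᵘ (frac c (suc e))
    ∎)
    where open ℚᵘ.≤-Reasoning

  frac-nonneg : ∀ a b → 0ℚ ℚ.≤ frac a b
  frac-nonneg a zero    = ℚ.≤-refl
  frac-nonneg a (suc b) = frac-≤ 0 1 a (suc b) (s≤s z≤n) (s≤s z≤n) z≤n

  +-cross : ∀ a b c → ℤ.+ (a + b) ℤ.* ℤ.+ (c * c) ≡ (ℤ.+ a ℤ.* ℤ.+ c ℤ.+ ℤ.+ b ℤ.* ℤ.+ c) ℤ.* ℤ.+ c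
  +-cross a b c = begin
      ℤ.+ (a + b) ℤ.* ℤ.+ (c * c)
    ≡⟨ ℤ.pos-* (a + b) (c * c) ⟨
      ℤ.+ ((a + b) * (c * c))
    ≡⟨ cong ℤ.+_ (trans (sym (*-assoc (a + b) c c)) (cong (_* c) (*-distribʳ-+ c a b))) ⟩
      ℤ.+ ((a * c + b * c) * c)
    ≡⟨ ℤ.pos-* (a * c + b * c) c ⟩
      ℤ.+ (a * c + b * c) ℤ.* ℤ.+ c
    ≡⟨ cong (ℤ._* ℤ.+ c) (trans (ℤ.pos-+ (a * c) (b * c)) (cong₂ ℤ._+_ (ℤ.pos-* a c) (ℤ.pos-* b c))) ⟩
      (ℤ.+ a ℤ.* ℤ.+ c ℤ.+ ℤ.+ b ℤ.* ℤ.+ c) ℤ.* ℤ.+ c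
    ∎
    where open ≡-Reasoning

  frac-+ : ∀ a b c → 0 < c → frac (a + b) c ℚ.≤ frac a c ℚ.+ frac b c
  frac-+ a b (suc c) _ = ℚ.toℚᵘ-cancel-≤ (begin
      toℚᵘ (frac (a + b) (suc c))
    ≃⟨ frac-≃ (a + b) c ⟩
      mkℚᵘ (ℤ.+ (a + b)) c
    ≤⟨ *≤* (ℤ.≤-reflexive (+-cross a b (suc c))) ⟩
      mkℚᵘ (ℤ.+ a) c ℚᵘ.+ mkℚᵘ (ℤ.+ b) c
    ≃⟨ ℚᵘ.≃-sym (ℚᵘ.+-cong (frac-≃ a c) (frac-≃ b c)) ⟩
      toℚᵘ (frac a (suc c)) ℚᵘ.+ toℚᵘ (frac b (suc c))
    ≃⟨ ℚᵘ.≃-sym (ℚ.toℚᵘ-homo-+ (frac a (suc c)) (frac b (suc c))) ⟩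
      toℚᵘ (frac a (suc c) ℚ.+ frac b (suc c))
    ∎)
    where open ℚᵘ.≤-Reasoning

  sumFin-mono : ∀ {n} {f g : Fin n → ℚ} → (∀ i → f i ℚ.≤ g i) → sumFin f ℚ.≤ sumFin g
  sumFin-mono {zero}  h = ℚ.≤-refl
  sumFin-mono {suc n} h = ℚ.+-mono-≤ (h zero) (sumFin-mono (λ i → h (suc i)))

  sumFin-nonneg : ∀ {n} (f : Fin n → ℚ) → (∀ i → 0ℚ ℚ.≤ f i) → 0ℚ ℚ.≤ sumFin f
  sumFin-nonneg {zero}  f h = ℚ.≤-refl
  sumFin-nonneg {suc n} f h = ℚ.+-mono-≤ (h zero) (sumFin-nonneg (λ i → f (suc i)) (λ i → h (suc i)))

  frac-∑ : ∀ {m} (f : Fin m → ℕ) c → 0 < c → frac (∑[ i < m ] f i) c ℚ.≤ sumFin (λ i → frac (f i) c)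
  frac-∑ {zero}  f c c>0 = frac-≤ 0 c 0 1 c>0 (s≤s z≤n) z≤n
  frac-∑ {suc m} f c c>0 =
    ℚ.≤-trans (frac-+ (f zero) (∑[ i < m ] f (suc i)) c c>0)
              (ℚ.+-monoʳ-≤ (frac (f zero) c) (frac-∑ (λ i → f (suc i)) c c>0))

  vertex-term-bound : ∀ K d N → ¬ d ≡ 0 → 0 < N → K * (2 ^ d ∸ 1) ≤ d * N →
                      frac K (2 * N) ℚ.≤ frac d (2 ^ (d + 1) ∸ 2)
  vertex-term-bound K d N d≢0 N>0 KN≤dN =
    frac-≤ K (2 * N) d (2 ^ (d + 1) ∸ 2) (*-monoʳ-< 2 N>0) D>0 cross
    where
    q : ℕ
    q = 2 ^ d ∸ 1
    D≡2q : 2 ^ (d + 1) ∸ 2 ≡ 2 * q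
    D≡2q = trans (cong (λ e → 2 ^ e ∸ 2) (+-comm d 1)) (sym (*-distribˡ-∸ 2 (2 ^ d) 1))
    D>0 : 0 < 2 ^ (d + 1) ∸ 2
    D>0 = subst (0 <_) (sym D≡2q) (*-monoʳ-< 2 (m<n⇒0<n∸m 1<2^d))
      where
      1<2^d : 1 < 2 ^ d
      1<2^d = ^-monoʳ-< 2 (s≤s (s≤s z≤n)) (n≢0⇒n>0 d≢0)
    cross : K * (2 ^ (d + 1) ∸ 2) ≤ d * (2 * N)
    cross = begin
        K * (2 ^ (d + 1) ∸ 2)
      ≡⟨ cong (K *_) D≡2q ⟩
        K * (2 * q)
      ≡⟨ *-left-comm K 2 q ⟩
        2 * (K * q)
      ≤⟨ *-monoʳ-≤ 2 KN≤dN ⟩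
        2 * (d * N)
      ≡⟨ *-left-comm 2 d N ⟩
        d * (2 * N)
      ∎
      where open ≤-Reasoning

  ratio-bound : ∀ n tot N (K d : Fin n → ℕ) → (∀ u → ¬ d u ≡ 0) →
                2 * tot ≤ n * N + ∑[ u < n ] K u → (∀ u → K u * (2 ^ d u ∸ 1) ≤ d u * N) →
                frac tot N ℚ.≤ frac n 2 ℚ.+ sumFin (λ u → frac (d u) (2 ^ (d u + 1) ∸ 2))
  ratio-bound n tot zero K d d≢0 total perVertex =
    ℚ.+-mono-≤ (frac-nonneg n 2) (sumFin-nonneg _ (λ u → frac-nonneg (d u) (2 ^ (d u + 1) ∸ 2)))
  ratio-bound n tot N@(suc _) K d d≢0 total perVertex = begin
      frac tot N
    ≤⟨ frac-≤ tot N (n * N + ∑[ u < n ] K u) (2 * N) N>0 2N>0 cross ⟩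
      frac (n * N + ∑[ u < n ] K u) (2 * N)
    ≤⟨ frac-+ (n * N) (∑[ u < n ] K u) (2 * N) 2N>0 ⟩
      frac (n * N) (2 * N) ℚ.+ frac (∑[ u < n ] K u) (2 * N)
    ≤⟨ ℚ.+-mono-≤ (frac-≤ (n * N) (2 * N) n 2 2N>0 (s≤s z≤n) (≤-reflexive halve))
                  (frac-∑ K (2 * N) 2N>0) ⟩
      frac n 2 ℚ.+ sumFin (λ u → frac (K u) (2 * N))
    ≤⟨ ℚ.+-monoʳ-≤ (frac n 2)
                   (sumFin-mono (λ u → vertex-term-bound (K u) (d u) N (d≢0 u) N>0 (perVertex u))) ⟩
      frac n 2 ℚ.+ sumFin (λ u → frac (d u) (2 ^ (d u + 1) ∸ 2))
    ∎
    where
    open ℚ.≤-Reasoning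
    N>0 : 0 < N
    N>0 = s≤s z≤n
    2N>0 : 0 < 2 * N
    2N>0 = *-monoʳ-< 2 N>0
    cross : tot * (2 * N) ≤ (n * N + ∑[ u < n ] K u) * N
    cross = ≤-trans (≤-reflexive (trans (*-left-comm tot 2 N) (sym (*-assoc 2 tot N))))
                    (*-monoˡ-≤ N total)
    halve : n * N * 2 ≡ n * (2 * N)
    halve = trans (*-assoc n N 2) (cong (n *_) (*-comm N 2))

open import Data.Rational using (_≤_)
open Combinatorics using (module Domination)
open Arithmetic using (ratio-bound)

theorem3p6 : (n : ℕ) (G : Graph n) → NoIsolated G → avd G ≤ avdBound G
theorem3p6 n G noIsolated =
  subst (_≤ avdBound G) avd-as-ratio
        (ratio-bound n totalSize nDom nPrivateFrom (deg G) noIsolated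
                     twice-totalSize PrivateNeighbourBound.private-neighbour-bound)
  where open Domination G
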